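{- Let $V$ be a finite set of $n$ variables and let $\mathcal{B}$ be a Sperner family of $m$ nonempty proper subsets of $V$ with $\bigcup_{B\in\mathcal{B}}B=V$ and $\bigcap_{B\in\mathcal{B}}B=\emptyset$. Then $OPT_*(\mathcal{B})\ge m$ for all measures $*\in\{B,BA,TA,C,BC,L\}$, and $OPT_*(\mathcal{B})\ge n$ for $*\in\{TA,C,BC,L\}$. Furthermore, $OPT_L(\mathcal{B})\ge\max\{n(\delta+1),2m\}$, where $\delta$ is the size of a smallest member of $\mathcal{B}$.
   Context: A pure Horn clause $B\rightarrow v$, with $\emptyset\neq B\subseteq V$ and $v\in V\setminus B$, is the clause $v\vee\bigvee_{u\in B}\overline{u}$. For $H\subseteq V\setminus B$, $B\rightarrow H$ abbreviates $\bigwedge_{v\in H}B\rightarrow v$. A pure Horn CNF grouped by bodies is written $\Phi=\bigwedge_{i=1}^{r}B_i\rightarrow H_i$ with distinct bodies $B_i$ and nonempty $H_i$. Measures: $|\Phi|_B=r$, $|\Phi|_{BA}=\sum_i|B_i|$, $|\Phi|_{TA}=\sum_i(|B_i|+|H_i|)$, $|\Phi|_C=\sum_i|H_i|$, $|\Phi|_{BC}=\sum_i(|H_i|+1)$, $|\Phi|_L=\sum_i(|B_i|+1)|H_i|$. The key Horn function $h_{\mathcal{B}}$ is represented by $\bigwedge_{B\in\mathcal{B}}B\rightarrow(V\setminus B)$; a representation is any equivalent pure Horn CNF and $OPT_*(\mathcal{B})$ is the minimum of $|\cdot|_*$ over representations. Sperner means no member of $\mathcal{B}$ is a proper subset of another.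 -}

module Defs where

open import Data.Nat using (ℕ; _+_; _*_)
open import Data.Fin using (Fin)
open import Data.Fin.Subset using (Subset; _∈_; _∉_; _⊆_; _⊂_; ∁; ∣_∣; Nonempty; ⊤)
open import Data.List using (List; []; _∷_; map; length)
open import Data.List.Membership.Propositional using () renaming (_∈_ to _∈ₗ_)
open import Data.List.Relation.Unary.All using (All)
open import Data.List.Relation.Unary.Unique.Propositional using (Unique)
open import Data.Product using (_×_; _,_; proj₁)
open import Relation.Binary.PropositionalEquality using (_≡_; _≢_)
open import Function.Bundles using (_⇔_)
open import Relation.Nullary using (¬_)

-- The variable set V is Fin n; subsets of V are Data.Fin.Subset.
-- A group "B → H" of pure Horn clauses is a pair (B , H).
HornGroup : ℕ → Set
HornGroup n = Subset n × Subset n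

HornCNF : ℕ → Set
HornCNF n = List (HornGroup n)

WellFormedGroup : ∀ {n} → HornGroup n → Set
WellFormedGroup (B , H) =
  Nonempty B × Nonempty H × (∀ {v} → v ∈ H → v ∉ B)

WellFormed : ∀ {n} → HornCNF n → Set
WellFormed Φ = All WellFormedGroup Φ × Unique (map proj₁ Φ)

-- Semantics: a truth assignment is the subset x of variables set to true.
-- The clauses B → v (v ∈ H) hold in x iff (B ⊆ x implies H ⊆ x).
SatGroup : ∀ {n} → Subset n → HornGroup n → Set
SatGroup x (B , H) = B ⊆ x → H ⊆ x

Sat : ∀ {n} → HornCNF n → Subset n → Set
Sat Φ x = All (SatGroup x) Φ

keyCNF : ∀ {n} → List (Subset n) → HornCNF n
keyCNF 𝓑 = map (λ B → (B , ∁ B)) 𝓑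

Represents : ∀ {n} → HornCNF n → List (Subset n) → Set
Represents Φ 𝓑 = WellFormed Φ × (∀ x → Sat Φ x ⇔ Sat (keyCNF 𝓑) x)

data Measure : Set where
  mB mBA mTA mC mBC mL : Measure

groupSize : ∀ {n} → Measure → HornGroup n → ℕ
groupSize mB  (B , H) = 1
groupSize mBA (B , H) = ∣ B ∣
groupSize mTA (B , H) = ∣ B ∣ + ∣ H ∣
groupSize mC  (B , H) = ∣ H ∣
groupSize mBC (B , H) = ∣ H ∣ + 1
groupSize mL  (B , H) = (∣ B ∣ + 1) * ∣ H ∣

size : ∀ {n} → Measure → HornCNF n → ℕ
size μ []       = 0
size μ (g ∷ Φ)  = groupSize μ g + size μ Φ

data HeadCounting : Measure → Set where
  hTA : HeadCounting mTA
  hC  : HeadCounting mC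
  hBC : HeadCounting mBC
  hL  : HeadCounting mL

Sperner : ∀ {n} → List (Subset n) → Set
Sperner 𝓑 = ∀ {A B} → A ∈ₗ 𝓑 → B ∈ₗ 𝓑 → ¬ (A ⊂ B)

module Submission where

-- Every member B of 𝓑 occurs as a body of Φ: as B ≠ V, the point B is a false point of
-- h_𝓑, so Φ has a group B′ → H′ violated at B, i.e. B′ ⊆ B; but B′ is itself a false point
-- (its head is nonempty and disjoint from it), so B′ contains a member of 𝓑, and the Sperner
-- property forces B′ = B.  Hence Φ has at least m groups.  Every variable v occurs in a head:
-- some member of 𝓑 avoids v since ⋂ 𝓑 = ∅, so V ∖ {v} is a false point, and the group of Φ
-- violated there has v in its head.  Hence |Φ|_C ≥ n.  Finally each body contains a member
-- of 𝓑 and so has at least δ elements, which gives |Φ|_L ≥ (δ + 1) |Φ|_C.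

open import Defs
open import Data.Nat using (ℕ; _+_; _*_; _≤_; _⊔_)
open import Data.Fin.Subset using (Subset; ∣_∣; Nonempty; ⊤; ⊥; ⋃; ⋂)
open import Data.List using (List; length)
open import Data.List.Membership.Propositional using (_∈_)
open import Data.List.Relation.Unary.All using (All)
open import Data.List.Relation.Unary.Unique.Propositional using (Unique)
open import Data.Product using (_×_; Σ-syntax)
open import Relation.Binary.PropositionalEquality using (_≡_; _≢_)

open import Data.Nat using (suc; z≤n; s≤s)
open import Data.Nat.Properties
  using (≤-refl; ≤-trans; ≤-reflexive; n≤1+n; m≤m+n; m≤n+m; +-suc; +-mono-≤; +-monoˡ-≤; +-monoʳ-≤;
         *-comm; *-zeroʳ; *-identityˡ; *-distribˡ-+; *-mono-≤; *-monoˡ-≤; *-monoʳ-≤; ⊔-lub;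
         module ≤-Reasoning)
open import Data.Bool using (true; false)
open import Data.Vec using ([]; _∷_)
open import Data.Fin using (Fin)
open import Data.Fin.Subset using (_⊆_; _∪_; ∁; ⁅_⁆; _∉_; _⊂_) renaming (_∈_ to _∈ˢ_)
open import Data.Fin.Subset.Properties
  using (_∈?_; _⊆?_; ⊆-refl; ⊆-trans; ⊆-antisym; ⊆⊤; x∈p∩q⁺; p⊆p∪q; q⊆p∪q; x∈⁅x⁆; x∈⁅y⁆⇒x≡y;
         x∈∁p⇒x∉p; x∉p⇒x∈∁p; x∈p⇒∣p-x∣<∣p∣; p⊆q⇒∣p∣≤∣q∣; ∈⊤; ∉⊥; ∣⊥∣≡0; ∣⊤∣≡n)
open import Data.List using ([]; _∷_; map)
open import Data.List.Properties using (length-map; length-removeAt′)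
open import Data.List.Membership.Propositional using (find; _─_)
open import Data.List.Membership.Propositional.Properties using (∈-map⁺; ∈-map⁻)
open import Data.List.Relation.Unary.Any using (here; there)
import Data.List.Relation.Unary.All as All
open import Data.List.Relation.Unary.All using ([]; _∷_)
open import Data.List.Relation.Unary.All.Properties using (¬All⇒Any¬)
open import Data.List.Relation.Unary.AllPairs using (_∷_)
open import Data.Product using (_,_; proj₁; proj₂; ∃-syntax)
open import Data.Empty using (⊥-elim)
open import Function using (_∘_; const)
open import Function.Bundles using (Equivalence)
open import Relation.Nullary using (¬_; Dec; yes; no; _→-dec_)
open import Relation.Nullary.Decidable using (decidable-stable)
open import Relation.Binary.PropositionalEquality using (refl; sym; subst; cong)

private
  variable
    k : ℕ
    A : Set

∈-─⁺ : ∀ {x y : A} {xs} (x∈xs : x ∈ xs) → y ∈ xs → x ≢ y → y ∈ xs ─ x∈xs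
∈-─⁺ (here refl) (here refl) x≢y = ⊥-elim (x≢y refl)
∈-─⁺ (here refl) (there y∈xs) x≢y = y∈xs
∈-─⁺ (there x∈xs) (here refl) x≢y = here refl
∈-─⁺ (there x∈xs) (there y∈xs) x≢y = there (∈-─⁺ x∈xs y∈xs x≢y)

Unique⇒length≤ : ∀ {xs ys : List A} → Unique xs → All (_∈ ys) xs → length xs ≤ length ys
Unique⇒length≤ {xs = []} _ _ = z≤n
Unique⇒length≤ {xs = x ∷ xs} {ys} (x∉xs ∷ xs-unique) (x∈ys ∷ xs⊆ys) = ≤-trans
  (s≤s (Unique⇒length≤ xs-unique (All.zipWith (λ (x≢y , y∈ys) → ∈-─⁺ x∈ys y∈ys x≢y) (x∉xs , xs⊆ys))))
  (≤-reflexive (sym (length-removeAt′ ys _)))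

∣p∪q∣≤∣p∣+∣q∣ : (p q : Subset k) → ∣ p ∪ q ∣ ≤ ∣ p ∣ + ∣ q ∣
∣p∪q∣≤∣p∣+∣q∣ [] [] = z≤n
∣p∪q∣≤∣p∣+∣q∣ (true ∷ p) (true ∷ q) = s≤s (≤-trans (∣p∪q∣≤∣p∣+∣q∣ p q) (+-monoʳ-≤ ∣ p ∣ (n≤1+n _)))
∣p∪q∣≤∣p∣+∣q∣ (true ∷ p) (false ∷ q) = s≤s (∣p∪q∣≤∣p∣+∣q∣ p q)
∣p∪q∣≤∣p∣+∣q∣ (false ∷ p) (true ∷ q) = ≤-trans (s≤s (∣p∪q∣≤∣p∣+∣q∣ p q)) (≤-reflexive (sym (+-suc ∣ p ∣ ∣ q ∣)))
∣p∪q∣≤∣p∣+∣q∣ (false ∷ p) (false ∷ q) = ∣p∪q∣≤∣p∣+∣q∣ p q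

Nonempty⇒1≤∣p∣ : {p : Subset k} → Nonempty p → 1 ≤ ∣ p ∣
Nonempty⇒1≤∣p∣ (_ , x∈p) = ≤-trans (s≤s z≤n) (x∈p⇒∣p-x∣<∣p∣ x∈p)

⊆∧⊄⇒⊇ : {p q : Subset k} → p ⊆ q → ¬ (p ⊂ q) → q ⊆ p
⊆∧⊄⇒⊇ {p = p} p⊆q p⊄q {x} x∈q = decidable-stable (x ∈? p) (λ x∉p → p⊄q (p⊆q , x , x∈q , x∉p))

∁p⊆p⇒p≡⊤ : {p : Subset k} → ∁ p ⊆ p → p ≡ ⊤
∁p⊆p⇒p≡⊤ {p = p} ∁p⊆p = ⊆-antisym ⊆⊤ λ {x} _ →
  decidable-stable (x ∈? p) (λ x∉p → x∉p (∁p⊆p (x∉p⇒x∈∁p x∉p)))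

x∉p⇒p⊆∁⁅x⁆ : {p : Subset k} {x : Fin k} → x ∉ p → p ⊆ ∁ ⁅ x ⁆
x∉p⇒p⊆∁⁅x⁆ {p = p} {x} x∉p y∈p = x∉p⇒x∈∁p λ y∈⁅x⁆ → x∉p (subst (_∈ˢ p) (x∈⁅y⁆⇒x≡y x y∈⁅x⁆) y∈p)

¬p⊆∁⁅x⁆⇒x∈p : {p : Subset k} {x : Fin k} → ¬ (p ⊆ ∁ ⁅ x ⁆) → x ∈ˢ p
¬p⊆∁⁅x⁆⇒x∈p {p = p} {x} p⊈∁⁅x⁆ = decidable-stable (x ∈? p) (p⊈∁⁅x⁆ ∘ x∉p⇒p⊆∁⁅x⁆)

x∉p⇒∁p⊈∁⁅x⁆ : {p : Subset k} {x : Fin k} → x ∉ p → ¬ (∁ p ⊆ ∁ ⁅ x ⁆)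
x∉p⇒∁p⊈∁⁅x⁆ {x = x} x∉p ∁p⊆∁⁅x⁆ = x∈∁p⇒x∉p (∁p⊆∁⁅x⁆ (x∉p⇒x∈∁p x∉p)) (x∈⁅x⁆ x)

x∈⋂⁺ : {x : Fin k} (ps : List (Subset k)) → All (x ∈ˢ_) ps → x ∈ˢ ⋂ ps
x∈⋂⁺ [] [] = ∈⊤
x∈⋂⁺ (p ∷ ps) (x∈p ∷ x∈ps) = x∈p∩q⁺ (x∈p , x∈⋂⁺ ps x∈ps)

x∉⋂⇒∃x∉ : {x : Fin k} (ps : List (Subset k)) → x ∉ ⋂ ps → ∃[ p ] (p ∈ ps × x ∉ p)
x∉⋂⇒∃x∉ {x = x} ps x∉⋂ = find (¬All⇒Any¬ (x ∈?_) ps (x∉⋂ ∘ x∈⋂⁺ ps))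

p∈ps⇒p⊆⋃ : {p : Subset k} {ps : List (Subset k)} → p ∈ ps → p ⊆ ⋃ ps
p∈ps⇒p⊆⋃ {ps = p ∷ ps} (here refl) = p⊆p∪q (⋃ ps)
p∈ps⇒p⊆⋃ {ps = q ∷ ps} (there p∈ps) = q⊆p∪q q (⋃ ps) ∘ p∈ps⇒p⊆⋃ p∈ps

Violates : Subset k → HornGroup k → Set
Violates x (B , H) = B ⊆ x × ¬ (H ⊆ x)

satGroup? : (x : Subset k) (g : HornGroup k) → Dec (SatGroup x g)
satGroup? x (B , H) = (B ⊆? x) →-dec (H ⊆? x)

¬SatGroup⇒Violates : {x : Subset k} (g : HornGroup k) → ¬ SatGroup x g → Violates x g
¬SatGroup⇒Violates {x = x} (B , H) ¬sat with B ⊆? x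
... | yes B⊆x = B⊆x , ¬sat ∘ const
... | no B⊈x = ⊥-elim (¬sat (⊥-elim ∘ B⊈x))

¬Sat⇒∃Violates : {x : Subset k} (Φ : HornCNF k) → ¬ Sat Φ x → ∃[ g ] (g ∈ Φ × Violates x g)
¬Sat⇒∃Violates {x = x} Φ ¬sat with find (¬All⇒Any¬ (satGroup? x) Φ ¬sat)
... | g , g∈Φ , ¬satg = g , g∈Φ , ¬SatGroup⇒Violates g ¬satg

Violates⇒¬Sat : {x B H : Subset k} {Φ : HornCNF k} → (B , H) ∈ Φ → Violates x (B , H) → ¬ Sat Φ x
Violates⇒¬Sat g∈Φ (B⊆x , H⊈x) sat = H⊈x (All.lookup sat g∈Φ B⊆x)

WellFormedGroup⇒Violates-body : {B H : Subset k} → WellFormedGroup (B , H) → Violates B (B , H)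
WellFormedGroup⇒Violates-body (_ , (v , v∈H) , H∩B≡∅) = ⊆-refl , λ H⊆B → H∩B≡∅ v∈H (H⊆B v∈H)

member-Violates⇒¬Sat-keyCNF : {𝓑 : List (Subset k)} {B x : Subset k} →
  B ∈ 𝓑 → B ⊆ x → ¬ (∁ B ⊆ x) → ¬ Sat (keyCNF 𝓑) x
member-Violates⇒¬Sat-keyCNF B∈𝓑 B⊆x ∁B⊈x = Violates⇒¬Sat (∈-map⁺ (λ C → C , ∁ C) B∈𝓑) (B⊆x , ∁B⊈x)

¬Sat-keyCNF⇒∃member⊆ : {𝓑 : List (Subset k)} {x : Subset k} →
  ¬ Sat (keyCNF 𝓑) x → ∃[ B ] (B ∈ 𝓑 × B ⊆ x)
¬Sat-keyCNF⇒∃member⊆ {𝓑 = 𝓑} ¬sat with ¬Sat⇒∃Violates (keyCNF 𝓑) ¬sat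
... | g , g∈keyCNF , violated with ∈-map⁻ (λ C → C , ∁ C) g∈keyCNF
...   | B , B∈𝓑 , refl = B , B∈𝓑 , proj₁ violated

heads : HornCNF k → Subset k
heads Φ = ⋃ (map proj₂ Φ)

module _ {𝓑 : List (Subset k)} {Φ : HornCNF k} (Φ≈𝓑 : Represents Φ 𝓑) where

  private
    ¬Sat-keyCNF⇒¬Sat : {x : Subset k} → ¬ Sat (keyCNF 𝓑) x → ¬ Sat Φ x
    ¬Sat-keyCNF⇒¬Sat {x} ¬sat = ¬sat ∘ Equivalence.to (proj₂ Φ≈𝓑 x)

    ¬Sat⇒¬Sat-keyCNF : {x : Subset k} → ¬ Sat Φ x → ¬ Sat (keyCNF 𝓑) x
    ¬Sat⇒¬Sat-keyCNF {x} ¬sat = ¬sat ∘ Equivalence.from (proj₂ Φ≈𝓑 x)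

  body⊇member : {B H : Subset k} → (B , H) ∈ Φ → ∃[ C ] (C ∈ 𝓑 × C ⊆ B)
  body⊇member g∈Φ = ¬Sat-keyCNF⇒∃member⊆ (¬Sat⇒¬Sat-keyCNF
    (Violates⇒¬Sat g∈Φ (WellFormedGroup⇒Violates-body (All.lookup (proj₁ (proj₁ Φ≈𝓑)) g∈Φ))))

  member⇒body : Sperner 𝓑 → {B : Subset k} → B ∈ 𝓑 → B ≢ ⊤ → B ∈ map proj₁ Φ
  member⇒body sperner {B} B∈𝓑 B≢⊤
    with ¬Sat⇒∃Violates Φ (¬Sat-keyCNF⇒¬Sat
           (member-Violates⇒¬Sat-keyCNF B∈𝓑 ⊆-refl (B≢⊤ ∘ ∁p⊆p⇒p≡⊤)))
  ... | (B′ , H′) , g∈Φ , B′⊆B , _ with body⊇member g∈Φ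
  ...   | C , C∈𝓑 , C⊆B′ = subst (_∈ map proj₁ Φ) B′≡B (∈-map⁺ proj₁ g∈Φ)
    where
      B⊆C : B ⊆ C
      B⊆C = ⊆∧⊄⇒⊇ (⊆-trans C⊆B′ B′⊆B) (sperner C∈𝓑 B∈𝓑)

      B′≡B : B′ ≡ B
      B′≡B = ⊆-antisym B′⊆B (⊆-trans B⊆C C⊆B′)

  All≤∣member∣⇒All≤∣body∣ : ∀ {δ} → All (λ C → δ ≤ ∣ C ∣) 𝓑 → All (λ g → δ ≤ ∣ proj₁ g ∣) Φ
  All≤∣member∣⇒All≤∣body∣ δ≤ = All.tabulate λ g∈Φ →
    let C , C∈𝓑 , C⊆B = body⊇member g∈Φ in ≤-trans (All.lookup δ≤ C∈𝓑) (p⊆q⇒∣p∣≤∣q∣ C⊆B)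

  ⋂≡⊥⇒⊤⊆heads : ⋂ 𝓑 ≡ ⊥ → ⊤ ⊆ heads Φ
  ⋂≡⊥⇒⊤⊆heads ⋂𝓑≡⊥ {v} _ with x∉⋂⇒∃x∉ 𝓑 (∉⊥ ∘ subst (v ∈ˢ_) ⋂𝓑≡⊥)
  ... | C , C∈𝓑 , v∉C
    with ¬Sat⇒∃Violates Φ (¬Sat-keyCNF⇒¬Sat
           (member-Violates⇒¬Sat-keyCNF C∈𝓑 (x∉p⇒p⊆∁⁅x⁆ v∉C) (x∉p⇒∁p⊈∁⁅x⁆ v∉C)))
  ...   | (B , H) , g∈Φ , _ , H⊈∁⁅v⁆ = p∈ps⇒p⊆⋃ (∈-map⁺ proj₂ g∈Φ) (¬p⊆∁⁅x⁆⇒x∈p H⊈∁⁅v⁆)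

∣heads∣≤size-mC : (Φ : HornCNF k) → ∣ heads Φ ∣ ≤ size mC Φ
∣heads∣≤size-mC {k} [] = ≤-reflexive (∣⊥∣≡0 k)
∣heads∣≤size-mC ((B , H) ∷ Φ) = ≤-trans (∣p∪q∣≤∣p∣+∣q∣ H (heads Φ)) (+-monoʳ-≤ ∣ H ∣ (∣heads∣≤size-mC Φ))

size-mB≡length : (Φ : HornCNF k) → size mB Φ ≡ length Φ
size-mB≡length [] = refl
size-mB≡length (_ ∷ Φ) = cong suc (size-mB≡length Φ)

size-mono : ∀ {μ ν} (Φ : HornCNF k) → All (λ g → groupSize μ g ≤ groupSize ν g) Φ → size μ Φ ≤ size ν Φ
size-mono [] [] = z≤n
size-mono (_ ∷ Φ) (g≤ ∷ Φ≤) = +-mono-≤ g≤ (size-mono Φ Φ≤)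

*-size-mono : ∀ {μ ν} c (Φ : HornCNF k) →
  All (λ g → c * groupSize μ g ≤ groupSize ν g) Φ → c * size μ Φ ≤ size ν Φ
*-size-mono c [] [] = ≤-reflexive (*-zeroʳ c)
*-size-mono {μ = μ} {ν} c (g ∷ Φ) (g≤ ∷ Φ≤) = begin
  c * (groupSize μ g + size μ Φ)     ≡⟨ *-distribˡ-+ c (groupSize μ g) (size μ Φ) ⟩
  c * groupSize μ g + c * size μ Φ   ≤⟨ +-mono-≤ g≤ (*-size-mono c Φ Φ≤) ⟩
  groupSize ν g + size ν Φ           ∎
  where open ≤-Reasoning

groupSize-mC≤groupSize : ∀ {μ} → HeadCounting μ → (g : HornGroup k) → groupSize mC g ≤ groupSize μ g
groupSize-mC≤groupSize hTA (B , H) = m≤n+m ∣ H ∣ ∣ B ∣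
groupSize-mC≤groupSize hC (B , H) = ≤-refl
groupSize-mC≤groupSize hBC (B , H) = m≤m+n ∣ H ∣ 1
groupSize-mC≤groupSize hL (B , H) =
  ≤-trans (≤-reflexive (sym (*-identityˡ ∣ H ∣))) (*-monoˡ-≤ ∣ H ∣ (m≤n+m 1 ∣ B ∣))

groupSize-mB≤groupSize : {g : HornGroup k} → WellFormedGroup g → ∀ μ → groupSize mB g ≤ groupSize μ g
groupSize-mB≤groupSize _ mB = ≤-refl
groupSize-mB≤groupSize (B≠∅ , _) mBA = Nonempty⇒1≤∣p∣ B≠∅
groupSize-mB≤groupSize {g = B , H} (B≠∅ , _) mTA = ≤-trans (Nonempty⇒1≤∣p∣ B≠∅) (m≤m+n ∣ B ∣ ∣ H ∣)
groupSize-mB≤groupSize (_ , H≠∅ , _) mC = Nonempty⇒1≤∣p∣ H≠∅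
groupSize-mB≤groupSize {g = B , H} _ mBC = m≤n+m 1 ∣ H ∣
groupSize-mB≤groupSize {g = g} (_ , H≠∅ , _) mL = ≤-trans (Nonempty⇒1≤∣p∣ H≠∅) (groupSize-mC≤groupSize hL g)

2*groupSize-mB≤groupSize-mL : {g : HornGroup k} → WellFormedGroup g → 2 * groupSize mB g ≤ groupSize mL g
2*groupSize-mB≤groupSize-mL (B≠∅ , H≠∅ , _) = *-mono-≤ (+-monoˡ-≤ 1 (Nonempty⇒1≤∣p∣ B≠∅)) (Nonempty⇒1≤∣p∣ H≠∅)

*-groupSize-mC≤groupSize-mL : ∀ {δ} {g : HornGroup k} → δ ≤ ∣ proj₁ g ∣ → (δ + 1) * groupSize mC g ≤ groupSize mL g
*-groupSize-mC≤groupSize-mL {g = B , H} δ≤∣B∣ = *-monoˡ-≤ ∣ H ∣ (+-monoˡ-≤ 1 δ≤∣B∣)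

length≤size : {Φ : HornCNF k} → All WellFormedGroup Φ → ∀ μ → length Φ ≤ size μ Φ
length≤size {Φ = Φ} wf μ = subst (_≤ size μ Φ) (size-mB≡length Φ)
  (size-mono Φ (All.map (λ wfg → groupSize-mB≤groupSize wfg μ) wf))

2*length≤size-mL : {Φ : HornCNF k} → All WellFormedGroup Φ → 2 * length Φ ≤ size mL Φ
2*length≤size-mL {Φ = Φ} wf = subst (λ l → 2 * l ≤ size mL Φ) (size-mB≡length Φ)
  (*-size-mono 2 Φ (All.map 2*groupSize-mB≤groupSize-mL wf))

size-mC≤size : ∀ {μ} → HeadCounting μ → (Φ : HornCNF k) → size mC Φ ≤ size μ Φ
size-mC≤size hc Φ = size-mono Φ (All.tabulate λ {g} _ → groupSize-mC≤groupSize hc g)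

*-size-mC≤size-mL : ∀ δ (Φ : HornCNF k) → All (λ g → δ ≤ ∣ proj₁ g ∣) Φ → (δ + 1) * size mC Φ ≤ size mL Φ
*-size-mC≤size-mL δ Φ δ≤ = *-size-mono (δ + 1) Φ (All.map (λ {g} → *-groupSize-mC≤groupSize-mL {g = g}) δ≤)

lemma2 : (n m : ℕ) (𝓑 : List (Subset n)) →
    Unique 𝓑 → length 𝓑 ≡ m →
    Sperner 𝓑 →
    All Nonempty 𝓑 → All (λ B → B ≢ ⊤) 𝓑 →
    ⋃ 𝓑 ≡ ⊤ → ⋂ 𝓑 ≡ ⊥ →
    (δ : ℕ) → Σ[ B ∈ Subset n ] (B ∈ 𝓑 × ∣ B ∣ ≡ δ) → All (λ B → δ ≤ ∣ B ∣) 𝓑 →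
    (Φ : HornCNF n) → Represents Φ 𝓑 →
      ((μ : Measure) → m ≤ size μ Φ)
      × ((μ : Measure) → HeadCounting μ → n ≤ size μ Φ)
      × (n * (δ + 1) ⊔ 2 * m ≤ size mL Φ)
lemma2 n _ 𝓑 𝓑-unique refl sperner _ 𝓑≢⊤ _ ⋂𝓑≡⊥ δ _ δ≤ Φ Φ≈𝓑 =
  (λ μ → ≤-trans m≤length (length≤size wf μ)) ,
  (λ μ hc → ≤-trans n≤size-mC (size-mC≤size hc Φ)) ,
  ⊔-lub n*[δ+1]≤size-mL (≤-trans (*-monoʳ-≤ 2 m≤length) (2*length≤size-mL wf))
  where
    open ≤-Reasoning
    wf = proj₁ (proj₁ Φ≈𝓑)

    m≤length : length 𝓑 ≤ length Φ
    m≤length = ≤-trans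
      (Unique⇒length≤ 𝓑-unique (All.tabulate λ B∈𝓑 → member⇒body Φ≈𝓑 sperner B∈𝓑 (All.lookup 𝓑≢⊤ B∈𝓑)))
      (≤-reflexive (length-map proj₁ Φ))

    n≤size-mC : n ≤ size mC Φ
    n≤size-mC = begin
      n              ≡⟨ sym (∣⊤∣≡n n) ⟩
      ∣ ⊤ {n} ∣      ≤⟨ p⊆q⇒∣p∣≤∣q∣ (⋂≡⊥⇒⊤⊆heads Φ≈𝓑 ⋂𝓑≡⊥) ⟩
      ∣ heads Φ ∣    ≤⟨ ∣heads∣≤size-mC Φ ⟩
      size mC Φ      ∎

    n*[δ+1]≤size-mL : n * (δ + 1) ≤ size mL Φ
    n*[δ+1]≤size-mL = begin
      n * (δ + 1)          ≡⟨ *-comm n (δ + 1) ⟩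
      (δ + 1) * n          ≤⟨ *-monoʳ-≤ (δ + 1) n≤size-mC ⟩
      (δ + 1) * size mC Φ  ≤⟨ *-size-mC≤size-mL δ Φ (All≤∣member∣⇒All≤∣body∣ Φ≈𝓑 δ≤) ⟩
      size mL Φ            ∎
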